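{- Let $G$ be a non-trivial finite group and $n\ge 0$ an integer. Then the extended lift matroid $M_+(K_n^G)$ is round.
   Context: A loopless gain graph $\Gamma=(V_\Gamma,E_\Gamma,G_\Gamma)$ consists of a finite vertex set, a group $G_\Gamma$, and a finite set $E_\Gamma$ of edges $\{u,v\}_g$ (classes of triples $(u,v,g)$, $u\ne v$, $g\in G_\Gamma$, with $(u,v,g)\sim(v,u,g^{ -1})$). A cycle is a set of edges $\{v_1,v_2\}_{g_1},\dots,\{v_m,v_1\}_{g_m}$ on distinct vertices, $m\ge2$ (two distinct edges when $m=2$); it is balanced if $g_1\cdots g_m$ is the identity, otherwise unbalanced. The extended lift matroid $M_+(\Gamma)$ is the matroid on $E_\Gamma\sqcup\{\infty\}$ in which $S$ is independent iff $S\cap E_\Gamma$ contains no balanced cycle and $S$ contains at most one of: the element $\infty$, an unbalanced cycle (that is, either $\infty\notin S$ and $S$ contains at most one unbalanced cycle, or $\infty\in S$ and $S\cap E_\Gamma$ contains no cycle). $K_n^G$ is the loopless gain graph on $[n]$ with gain group $G$ and all edges $\{i,j\}_g$, $i\ne j$, $g\in G$. A matroid is round if its ground set is not the union of two proper flats. -}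

module Defs where

open import Data.Nat using (ℕ; zero; suc; _≤_)
open import Data.Fin using (Fin; zero; suc; _<_; toℕ)
open import Data.Fin.Properties using (<-cmp)
open import Data.Bool using (Bool; true; false)
open import Data.Maybe using (Maybe; just; nothing)
import Data.Maybe
import Data.Fin
import Data.Nat
import Relation.Nullary
open import Data.Product using (Σ; ∃; _×_; _,_)
open import Data.Sum using (_⊎_)
open import Data.Empty using (⊥)
open import Relation.Nullary using (¬_)
open import Relation.Binary using (tri<; tri≈; tri>)
open import Relation.Binary.PropositionalEquality using (_≡_; _≢_)
open import Function.Definitions using (Injective)
open import Algebra.Structures using (IsGroup)

-- A finite group, presented with carrier Fin k (k = |G|) and
-- propositional equality.  Every finite group is isomorphic to one of
-- these, and roundness is invariant under isomorphism.

record FinGroup (k : ℕ) : Set where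
  field
    _∙_     : Fin k → Fin k → Fin k
    ε       : Fin k
    _⁻¹     : Fin k → Fin k
    isGroup : IsGroup _≡_ _∙_ ε _⁻¹

NonTrivial : ∀ {k} → FinGroup k → Set
NonTrivial {k} G = Σ (Fin k) λ g → g ≢ FinGroup.ε G

module LiftMatroid {k : ℕ} (G : FinGroup k) (n : ℕ) where
  open FinGroup G

  -- Ground set E(K_n^G) ⊔ {∞}.  An edge {i,j}_g of K_n^G is stored by
  -- its unique representative (i, j, g) with i < j; the triple (j,i,g)
  -- with i < j denotes {i,j}_{g⁻¹}.
  data El : Set where
    ∞    : El
    edge : (i j : Fin n) → .(i < j) → Fin k → El

  -- The element {u,v}_g  (nothing if u = v, which never occurs below).
  edgeOf : Fin n → Fin n → Fin k → Maybe El
  edgeOf u v g with <-cmp u v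
  ... | tri< u<v _ _ = just (edge u v u<v g)
  ... | tri≈ _ _ _   = nothing
  ... | tri> _ _ v<u = just (edge v u v<u (g ⁻¹))

  Subset : Set
  Subset = El → Bool

  _∈ₛ_ : El → Subset → Set
  e ∈ₛ S = S e ≡ true

  _∈ₘ_ : Maybe El → Subset → Set
  just e  ∈ₘ S = e ∈ₛ S
  nothing ∈ₘ S = ⊥

  _⊆_ : Subset → Subset → Set
  S ⊆ T = ∀ e → e ∈ₛ S → e ∈ₛ T

  insert : El → Subset → Subset
  insert ∞ S ∞ = true
  insert ∞ S e = S e
  insert (edge i j _ g) S ∞ = S ∞
  insert (edge i j _ g) S (edge i' j' p g') with i Data.Fin.≟ i' | j Data.Fin.≟ j' | g Data.Fin.≟ g'
  ... | Relation.Nullary.yes _ | Relation.Nullary.yes _ | Relation.Nullary.yes _ = true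
  ... | _ | _ | _ = S (edge i' j' p g')

  step : ∀ {p} → Fin (suc p) → Maybe (Fin (suc p))
  step {zero}  zero    = nothing
  step {suc p} zero    = just (suc zero)
  step {suc p} (suc i) = Data.Maybe.map suc (step i)

  next : ∀ {p} → Fin (suc p) → Fin (suc p)
  next i = Data.Maybe.fromMaybe zero (step i)

  prod : ∀ {m} → (Fin m → Fin k) → Fin k
  prod {zero}  f = ε
  prod {suc m} f = f zero ∙ prod (λ i → f (suc i))

  -- A cycle  {v₀,v₁}_{g₀}, {v₁,v₂}_{g₁}, …, {v_{m-1},v₀}_{g_{m-1}}
  -- on m = suc p ≥ 2 distinct vertices; for m = 2 the two edges must be
  -- distinct.
  record Cycle : Set where
    field
      p     : ℕ
      2≤m   : 2 ≤ suc p
      vs    : Fin (suc p) → Fin n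
      gs    : Fin (suc p) → Fin k
      vs-inj : Injective _≡_ _≡_ vs
      distinct : ∀ i j → i ≢ j → edgeOf (vs i) (vs (next i)) (gs i)
                                  ≢ edgeOf (vs j) (vs (next j)) (gs j)

    edgeAt : Fin (suc p) → Maybe El
    edgeAt i = edgeOf (vs i) (vs (next i)) (gs i)

    gain : Fin k
    gain = prod gs

  open Cycle public

  Balanced : Cycle → Set
  Balanced C = gain C ≡ ε

  _∈C_ : El → Cycle → Set
  e ∈C C = ∃ λ i → edgeAt C i ≡ just e

  _⊑_ : Cycle → Subset → Set
  C ⊑ S = ∀ i → edgeAt C i ∈ₘ S

  SameCycle : Cycle → Cycle → Set
  SameCycle C D = ∀ e → (e ∈C C → e ∈C D) × (e ∈C D → e ∈C C)

  Independent : Subset → Set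
  Independent S =
      (∀ C → C ⊑ S → ¬ Balanced C)
    × (∞ ∈ₛ S → ∀ C → ¬ (C ⊑ S))
    × (∀ C D → C ⊑ S → D ⊑ S → ¬ Balanced C → ¬ Balanced D → SameCycle C D)

  _∈cl_ : El → Subset → Set
  e ∈cl X = e ∈ₛ X ⊎ (∃ λ I → I ⊆ X × Independent I × ¬ Independent (insert e I))

  Flat : Subset → Set
  Flat F = ∀ e → e ∈cl F → e ∈ₛ F

  ProperFlat : Subset → Set
  ProperFlat F = Flat F × (∃ λ e → ¬ (e ∈ₛ F))

  Round : Set
  Round = ¬ (∃ λ F₁ → ∃ λ F₂ → ProperFlat F₁ × ProperFlat F₂
                    × (∀ e → e ∈ₛ F₁ ⊎ e ∈ₛ F₂))

{-# OPTIONS --safe #-}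
-- Suppose the ground set is F₁ ∪ F₂ for proper flats with ∞ ∈ F₁. Together with ∞, two parallel
-- edges form a circuit, so a flat containing ∞ and one edge between u and v contains all of them,
-- and a flat containing two parallel edges with different gains contains ∞. Hence the parallel
-- class of an edge {a,b}_g missing from F₁ lies in F₂, and ∞ ∈ F₂ because G is non-trivial. Now
-- every pair of vertices is full (has all its edges) in F₁ or in F₂, and fullness is transitive
-- thanks to the balanced triangles {u,v}_ε, {v,w}_g, {w,u}_{g⁻¹}. Two transitive relations
-- covering all pairs, the first missing {a,b}, force the second to contain every pair, so F₂ is
-- the whole ground set.
module Submission where

open import Defs
open import Data.Nat using (ℕ; zero; suc; s≤s; z≤n)
open import Data.Fin using (Fin; zero; suc; _<_)
open import Data.Fin.Properties using (_≟_; _<?_; <-cmp; <⇒≢)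
open import Data.Bool using (false)
open import Data.Maybe using (Maybe; just; nothing)
open import Data.Maybe.Properties using (just-injective)
open import Data.Vec using ([]; _∷_; lookup)
open import Data.Product using (Σ-syntax; ∃; _×_; _,_; proj₁; proj₂)
open import Data.Sum using (_⊎_; inj₁; inj₂; [_,_]′; swap) renaming (map to ⊎-map)
open import Data.Empty using (⊥; ⊥-elim)
open import Function using (_∘_; id)
open import Function.Definitions using (Injective)
open import Relation.Nullary using (¬_; yes; no)
open import Relation.Nullary.Decidable using (recompute)
open import Relation.Binary using (Rel; Symmetric; DecidableEquality; tri<; tri≈; tri>)
open import Relation.Binary.PropositionalEquality
open import Algebra.Bundles using (Group)
open import Algebra.Structures using (IsGroup)
import Algebra.Properties.Group as GroupProperties

TransitiveOnDistinct : ∀ {a ℓ} {A : Set a} → Rel A ℓ → Set _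
TransitiveOnDistinct R = ∀ {x y z} → x ≢ y → y ≢ z → x ≢ z → R x y → R y z → R x z

module _ {a ℓ₁ ℓ₂} {A : Set a} (_≟ᴬ_ : DecidableEquality A) {R₁ : Rel A ℓ₁} {R₂ : Rel A ℓ₂}
         (cover : ∀ {x y} → x ≢ y → R₁ x y ⊎ R₂ x y)
         (sym₁ : Symmetric R₁) (sym₂ : Symmetric R₂)
         (trans₁ : TransitiveOnDistinct R₁) (trans₂ : TransitiveOnDistinct R₂) where

  ¬R₁⇒R₂-total : ∀ {a b} → a ≢ b → ¬ R₁ a b → ∀ {c d} → c ≢ d → R₂ c d
  ¬R₁⇒R₂-total {a} {b} a≢b ¬aR₁b = total
    where
    aR₂b : R₂ a b
    aR₂b = [ ⊥-elim ∘ ¬aR₁b , id ]′ (cover a≢b)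

    -- If x R₁ a, then x R₁ b would give a R₁ b; so x R₂ b, and x R₂ a follows via b.
    R₂-to-a : ∀ {x} → x ≢ a → R₂ x a
    R₂-to-a {x} x≢a with x ≟ᴬ b
    ... | yes refl = sym₂ aR₂b
    ... | no x≢b with cover x≢a | cover x≢b
    ...   | inj₂ xR₂a | _        = xR₂a
    ...   | inj₁ xR₁a | inj₁ xR₁b = ⊥-elim (¬aR₁b (trans₁ (x≢a ∘ sym) x≢b a≢b (sym₁ xR₁a) xR₁b))
    ...   | inj₁ _    | inj₂ xR₂b = trans₂ x≢b (a≢b ∘ sym) x≢a xR₂b (sym₂ aR₂b)

    total : ∀ {c d} → c ≢ d → R₂ c d
    total {c} {d} c≢d with c ≟ᴬ a | d ≟ᴬ a
    ... | yes refl | _        = sym₂ (R₂-to-a (c≢d ∘ sym))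
    ... | no c≢a   | yes refl = R₂-to-a c≢a
    ... | no c≢a   | no d≢a   = trans₂ c≢a (d≢a ∘ sym) c≢d (R₂-to-a c≢a) (sym₂ (R₂-to-a d≢a))

injective₂ : ∀ {a} {A : Set a} (f : Fin 2 → A) → f zero ≢ f (suc zero) → Injective _≡_ _≡_ f
injective₂ f f₀≢f₁ {zero}     {zero}     _  = refl
injective₂ f f₀≢f₁ {zero}     {suc zero} eq = ⊥-elim (f₀≢f₁ eq)
injective₂ f f₀≢f₁ {suc zero} {zero}     eq = ⊥-elim (f₀≢f₁ (sym eq))
injective₂ f f₀≢f₁ {suc zero} {suc zero} _  = refl

injective₃ : ∀ {a} {A : Set a} (f : Fin 3 → A) →
             f zero ≢ f (suc zero) → f zero ≢ f (suc (suc zero)) →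
             f (suc zero) ≢ f (suc (suc zero)) → Injective _≡_ _≡_ f
injective₃ f f₀≢f₁ f₀≢f₂ f₁≢f₂ {zero}           {zero}           _  = refl
injective₃ f f₀≢f₁ f₀≢f₂ f₁≢f₂ {zero}           {suc zero}       eq = ⊥-elim (f₀≢f₁ eq)
injective₃ f f₀≢f₁ f₀≢f₂ f₁≢f₂ {zero}           {suc (suc zero)} eq = ⊥-elim (f₀≢f₂ eq)
injective₃ f f₀≢f₁ f₀≢f₂ f₁≢f₂ {suc zero}       {zero}           eq = ⊥-elim (f₀≢f₁ (sym eq))
injective₃ f f₀≢f₁ f₀≢f₂ f₁≢f₂ {suc zero}       {suc zero}       _  = refl
injective₃ f f₀≢f₁ f₀≢f₂ f₁≢f₂ {suc zero}       {suc (suc zero)} eq = ⊥-elim (f₁≢f₂ eq)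
injective₃ f f₀≢f₁ f₀≢f₂ f₁≢f₂ {suc (suc zero)} {zero}           eq = ⊥-elim (f₀≢f₂ (sym eq))
injective₃ f f₀≢f₁ f₀≢f₂ f₁≢f₂ {suc (suc zero)} {suc zero}       eq = ⊥-elim (f₁≢f₂ (sym eq))
injective₃ f f₀≢f₁ f₀≢f₂ f₁≢f₂ {suc (suc zero)} {suc (suc zero)} _  = refl

module _ {k : ℕ} (G : FinGroup k) (n : ℕ) where
  open FinGroup G
  open LiftMatroid G n
  open IsGroup isGroup using (identityˡ; identityʳ; inverseʳ)

  private
    group : Group _ _
    group = record { isGroup = isGroup }

  open GroupProperties group using (⁻¹-involutive; ⁻¹-injective; inverseʳ-unique)

  edgeOf-< : ∀ {u v} g .(u<v : u < v) → edgeOf u v g ≡ just (edge u v u<v g)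
  edgeOf-< {u} {v} g u<v with <-cmp u v
  ... | tri< _ _ _   = refl
  ... | tri≈ u≮v _ _ = ⊥-elim (u≮v (recompute (u <? v) u<v))
  ... | tri> u≮v _ _ = ⊥-elim (u≮v (recompute (u <? v) u<v))

  edgeOf-> : ∀ {u v} g .(v<u : v < u) → edgeOf u v g ≡ just (edge v u v<u (g ⁻¹))
  edgeOf-> {u} {v} g v<u with <-cmp u v
  ... | tri< _ _ v≮u = ⊥-elim (v≮u (recompute (v <? u) v<u))
  ... | tri≈ _ _ v≮u = ⊥-elim (v≮u (recompute (v <? u) v<u))
  ... | tri> _ _ _   = refl

  edgeOf-diag : ∀ u g → edgeOf u u g ≡ nothing
  edgeOf-diag u g with <-cmp u u
  ... | tri< u<u _ _ = ⊥-elim (<⇒≢ u<u refl)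
  ... | tri≈ _ _ _   = refl
  ... | tri> _ _ u<u = ⊥-elim (<⇒≢ u<u refl)

  edgeOf-sym : ∀ u v g → edgeOf v u (g ⁻¹) ≡ edgeOf u v g
  edgeOf-sym u v g with <-cmp u v
  ... | tri< u<v _ _  = trans (edgeOf-> (g ⁻¹) u<v) (cong (just ∘ edge u v u<v) (⁻¹-involutive g))
  ... | tri≈ _ refl _ = edgeOf-diag u (g ⁻¹)
  ... | tri> _ _ v<u  = edgeOf-< (g ⁻¹) v<u

  edgeOf-just : ∀ {u v} g → u ≢ v → ∃ λ e → edgeOf u v g ≡ just e
  edgeOf-just {u} {v} g u≢v with <-cmp u v
  ... | tri< _ _ _   = _ , refl
  ... | tri≈ _ u≡v _ = ⊥-elim (u≢v u≡v)
  ... | tri> _ _ _   = _ , refl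

  just-edge-injective : ∀ {i j} .{i<j i<j′ : i < j} {g h} →
                        just (edge i j i<j g) ≡ just (edge i j i<j′ h) → g ≡ h
  just-edge-injective refl = refl

  edgeOf-injectiveʳ : ∀ {u v g h} → u ≢ v → edgeOf u v g ≡ edgeOf u v h → g ≡ h
  edgeOf-injectiveʳ {u} {v} u≢v with <-cmp u v
  ... | tri< _ _ _   = just-edge-injective
  ... | tri≈ _ u≡v _ = ⊥-elim (u≢v u≡v)
  ... | tri> _ _ _   = ⁻¹-injective ∘ just-edge-injective

  Joins : El → Fin n → Fin n → Set
  Joins ∞              _ _ = ⊥
  Joins (edge i j _ _) u v = (u ≡ i × v ≡ j) ⊎ (u ≡ j × v ≡ i)

  edgeOf-joins : ∀ {u v g e} → edgeOf u v g ≡ just e → Joins e u v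
  edgeOf-joins {u} {v} eq with <-cmp u v
  edgeOf-joins refl | tri< _ _ _ = inj₁ (refl , refl)
  edgeOf-joins ()   | tri≈ _ _ _
  edgeOf-joins refl | tri> _ _ _ = inj₂ (refl , refl)

  joins-endpoint : ∀ {e u v u′ v′} → Joins e u v → Joins e u′ v′ → u ≡ u′ ⊎ u ≡ v′
  joins-endpoint {edge _ _ _ _} (inj₁ (refl , _)) (inj₁ (refl , _)) = inj₁ refl
  joins-endpoint {edge _ _ _ _} (inj₁ (refl , _)) (inj₂ (_ , refl)) = inj₂ refl
  joins-endpoint {edge _ _ _ _} (inj₂ (refl , _)) (inj₁ (_ , refl)) = inj₂ refl
  joins-endpoint {edge _ _ _ _} (inj₂ (refl , _)) (inj₂ (refl , _)) = inj₁ refl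

  edgeOf-endpoint : ∀ {u v u′ v′ g g′} → u ≢ v → edgeOf u v g ≡ edgeOf u′ v′ g′ → u ≡ u′ ⊎ u ≡ v′
  edgeOf-endpoint {g = g} u≢v eq with edgeOf-just g u≢v
  ... | _ , eq₁ = joins-endpoint (edgeOf-joins eq₁) (edgeOf-joins (trans (sym eq) eq₁))

  edgeOf≢∞ : ∀ {u v g e} → edgeOf u v g ≡ just e → e ≢ ∞
  edgeOf≢∞ eq refl = edgeOf-joins eq

  ends-distinct : ∀ {i j : Fin n} → .(i < j) → i ≢ j
  ends-distinct {i} {j} i<j = <⇒≢ (recompute (i <? j) i<j)

  ∅ : Subset
  ∅ _ = false

  ⟨_,_⟩ : El → El → Subset
  ⟨ y , z ⟩ = insert y (insert z ∅)

  insert-here : ∀ e S → e ∈ₛ insert e S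
  insert-here ∞ S = refl
  insert-here (edge i j _ g) S with i ≟ i | j ≟ j | g ≟ g
  ... | yes _   | yes _   | yes _   = refl
  ... | no i≢i  | _       | _       = ⊥-elim (i≢i refl)
  ... | yes _   | no j≢j  | _       = ⊥-elim (j≢j refl)
  ... | yes _   | yes _   | no g≢g  = ⊥-elim (g≢g refl)

  insert-there : ∀ e S {x} → x ∈ₛ S → x ∈ₛ insert e S
  insert-there ∞              S {∞}              _   = refl
  insert-there ∞              S {edge _ _ _ _}   x∈S = x∈S
  insert-there (edge _ _ _ _) S {∞}              x∈S = x∈S
  insert-there (edge i j _ g) S {edge i′ j′ _ g′} x∈S with i ≟ i′ | j ≟ j′ | g ≟ g′
  ... | yes _ | yes _ | yes _ = refl
  ... | no _  | _     | _     = x∈S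
  ... | yes _ | no _  | _     = x∈S
  ... | yes _ | yes _ | no _  = x∈S

  insert⁻ : ∀ e S {x} → x ∈ₛ insert e S → x ≡ e ⊎ x ∈ₛ S
  insert⁻ ∞              S {∞}              _ = inj₁ refl
  insert⁻ ∞              S {edge _ _ _ _}   = inj₂
  insert⁻ (edge _ _ _ _) S {∞}              = inj₂
  insert⁻ (edge i j _ g) S {edge i′ j′ _ g′} with i ≟ i′ | j ≟ j′ | g ≟ g′
  ... | yes refl | yes refl | yes refl = λ _ → inj₁ refl
  ... | no _     | _        | _        = inj₂
  ... | yes _    | no _     | _        = inj₂
  ... | yes _    | yes _    | no _     = inj₂

  ∈-pairˡ : ∀ y z → y ∈ₛ ⟨ y , z ⟩
  ∈-pairˡ y z = insert-here y (insert z ∅)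

  ∈-pairʳ : ∀ y z → z ∈ₛ ⟨ y , z ⟩
  ∈-pairʳ y z = insert-there y _ {z} (insert-here z ∅)

  ∈-insert-pairˡ : ∀ x y z → y ∈ₛ insert x ⟨ y , z ⟩
  ∈-insert-pairˡ x y z = insert-there x _ {y} (∈-pairˡ y z)

  ∈-insert-pairʳ : ∀ x y z → z ∈ₛ insert x ⟨ y , z ⟩
  ∈-insert-pairʳ x y z = insert-there x _ {z} (∈-pairʳ y z)

  ∈-pair⁻ : ∀ y z {x} → x ∈ₛ ⟨ y , z ⟩ → x ≡ y ⊎ x ≡ z
  ∈-pair⁻ y z x∈ with insert⁻ y _ x∈
  ... | inj₁ x≡y = inj₁ x≡y
  ... | inj₂ x∈′ with insert⁻ z ∅ x∈′
  ...   | inj₁ x≡z = inj₂ x≡z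
  ...   | inj₂ ()

  pair⊆ : ∀ {y z S} → y ∈ₛ S → z ∈ₛ S → ⟨ y , z ⟩ ⊆ S
  pair⊆ {y} {z} y∈S z∈S x x∈ with ∈-pair⁻ y z x∈
  ... | inj₁ refl = y∈S
  ... | inj₂ refl = z∈S

  ∈ₘ⇒just : ∀ {m S} → m ∈ₘ S → ∃ λ e → m ≡ just e × e ∈ₛ S
  ∈ₘ⇒just {just e} e∈S = e , refl , e∈S

  ≡just⇒∈ₘ : ∀ {m e S} → m ≡ just e → e ∈ₛ S → m ∈ₘ S
  ≡just⇒∈ₘ refl e∈S = e∈S

  edgeOf-∈ₘ⇒≢ : ∀ {u v g S} → edgeOf u v g ∈ₘ S → u ≢ v
  edgeOf-∈ₘ⇒≢ {u} {g = g} {S} uv∈S refl = subst (_∈ₘ S) (edgeOf-diag u g) uv∈S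

  two-positions : (C : Cycle) → Σ[ i ∈ Fin (suc (p C)) ] Σ[ j ∈ Fin (suc (p C)) ] i ≢ j
  two-positions record { p = zero ; 2≤m = s≤s () }
  two-positions record { p = suc _ } = zero , suc zero , λ ()

  cycle-in-pair : ∀ y z (C : Cycle) → C ⊑ ⟨ y , z ⟩ → ∀ i →
                  edgeAt C i ≡ just y ⊎ edgeAt C i ≡ just z
  cycle-in-pair y z C C⊑ i with ∈ₘ⇒just (C⊑ i)
  ... | x , eq , x∈ with ∈-pair⁻ y z x∈
  ...   | inj₁ refl = inj₁ eq
  ...   | inj₂ refl = inj₂ eq

  no-three-edges-in-pair : ∀ y z (C : Cycle) → C ⊑ ⟨ y , z ⟩ →
                           ∀ {i j l} → i ≢ j → j ≢ l → i ≢ l → ⊥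
  no-three-edges-in-pair y z C C⊑ {i} {j} {l} i≢j j≢l i≢l
    with cycle-in-pair y z C C⊑ i | cycle-in-pair y z C C⊑ j | cycle-in-pair y z C C⊑ l
  ... | inj₁ eᵢ | inj₁ eⱼ | _       = distinct C i j i≢j (trans eᵢ (sym eⱼ))
  ... | inj₂ eᵢ | inj₂ eⱼ | _       = distinct C i j i≢j (trans eᵢ (sym eⱼ))
  ... | inj₁ eᵢ | _       | inj₁ eₗ = distinct C i l i≢l (trans eᵢ (sym eₗ))
  ... | inj₂ eᵢ | _       | inj₂ eₗ = distinct C i l i≢l (trans eᵢ (sym eₗ))
  ... | _       | inj₁ eⱼ | inj₁ eₗ = distinct C j l j≢l (trans eⱼ (sym eₗ))
  ... | _       | inj₂ eⱼ | inj₂ eₗ = distinct C j l j≢l (trans eⱼ (sym eₗ))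

  pair⊆cycle : ∀ y z (C : Cycle) → C ⊑ ⟨ y , z ⟩ → y ∈C C × z ∈C C
  pair⊆cycle y z C C⊑ with two-positions C
  ... | i , j , i≢j with cycle-in-pair y z C C⊑ i | cycle-in-pair y z C C⊑ j
  ...   | inj₁ eᵢ | inj₁ eⱼ = ⊥-elim (distinct C i j i≢j (trans eᵢ (sym eⱼ)))
  ...   | inj₁ eᵢ | inj₂ eⱼ = (i , eᵢ) , (j , eⱼ)
  ...   | inj₂ eᵢ | inj₁ eⱼ = (j , eⱼ) , (i , eᵢ)
  ...   | inj₂ eᵢ | inj₂ eⱼ = ⊥-elim (distinct C i j i≢j (trans eᵢ (sym eⱼ)))

  ∈C-pair⁻ : ∀ y z {e} (C : Cycle) → C ⊑ ⟨ y , z ⟩ → e ∈C C → e ≡ y ⊎ e ≡ z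
  ∈C-pair⁻ y z C C⊑ (i , eq) =
    ⊎-map (just-injective ∘ trans (sym eq)) (just-injective ∘ trans (sym eq))
          (cycle-in-pair y z C C⊑ i)

  ∈C-pair-transfer : ∀ y z {e} (C D : Cycle) → C ⊑ ⟨ y , z ⟩ → D ⊑ ⟨ y , z ⟩ → e ∈C C → e ∈C D
  ∈C-pair-transfer y z C D C⊑ D⊑ e∈C with ∈C-pair⁻ y z C C⊑ e∈C
  ... | inj₁ refl = proj₁ (pair⊆cycle y z D D⊑)
  ... | inj₂ refl = proj₂ (pair⊆cycle y z D D⊑)

  cycles-in-pair-same : ∀ y z (C D : Cycle) → C ⊑ ⟨ y , z ⟩ → D ⊑ ⟨ y , z ⟩ → SameCycle C D
  cycles-in-pair-same y z C D C⊑ D⊑ _ =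
    ∈C-pair-transfer y z C D C⊑ D⊑ , ∈C-pair-transfer y z D C D⊑ C⊑

  digon-unbalanced : (C : Cycle) → p C ≡ 1 → ¬ Balanced C
  digon-unbalanced record { p = zero } ()
  digon-unbalanced record { p = suc (suc _) } ()
  digon-unbalanced C@record { p = suc zero } refl balanced =
    distinct C zero (suc zero) (λ ()) (sym (begin
      edgeOf v₁ v₀ g₁       ≡⟨ cong (edgeOf v₁ v₀) g₁≡g₀⁻¹ ⟩
      edgeOf v₁ v₀ (g₀ ⁻¹)  ≡⟨ edgeOf-sym v₀ v₁ g₀ ⟩
      edgeOf v₀ v₁ g₀       ∎))
    where
    open ≡-Reasoning
    v₀ = vs C zero
    v₁ = vs C (suc zero)
    g₀ = gs C zero
    g₁ = gs C (suc zero)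
    g₁≡g₀⁻¹ : g₁ ≡ g₀ ⁻¹
    g₁≡g₀⁻¹ = inverseʳ-unique g₀ g₁ (trans (cong (g₀ ∙_) (sym (identityʳ g₁))) balanced)

  pair-independent : ∀ {y z} → y ≢ ∞ → z ≢ ∞ → Independent ⟨ y , z ⟩
  pair-independent {y} {z} y≢∞ z≢∞ =
    no-balanced , (λ ∞∈ → ⊥-elim (∞∉ ∞∈)) , (λ C D C⊑ D⊑ _ _ → cycles-in-pair-same y z C D C⊑ D⊑)
    where
    ∞∉ : ¬ (∞ ∈ₛ ⟨ y , z ⟩)
    ∞∉ ∞∈ = [ y≢∞ ∘ sym , z≢∞ ∘ sym ]′ (∈-pair⁻ y z ∞∈)
    no-balanced : ∀ C → C ⊑ ⟨ y , z ⟩ → ¬ Balanced C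
    no-balanced record { p = zero ; 2≤m = s≤s () }
    no-balanced C@record { p = suc zero }    _  = digon-unbalanced C refl
    no-balanced C@record { p = suc (suc _) } C⊑ _ =
      no-three-edges-in-pair y z C C⊑ {zero} {suc zero} {suc (suc zero)} (λ ()) (λ ()) (λ ())

  ∞-pair-independent : ∀ y → Independent ⟨ ∞ , y ⟩
  ∞-pair-independent y =
    (λ C C⊑ _ → no-cycle C C⊑) , (λ _ → no-cycle) , (λ C _ C⊑ _ _ _ → ⊥-elim (no-cycle C C⊑))
    where
    edge-is-y : ∀ (C : Cycle) → C ⊑ ⟨ ∞ , y ⟩ → ∀ i → edgeAt C i ≡ just y
    edge-is-y C C⊑ i = [ (λ eq → ⊥-elim (edgeOf≢∞ eq refl)) , id ]′ (cycle-in-pair ∞ y C C⊑ i)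
    no-cycle : ∀ C → ¬ (C ⊑ ⟨ ∞ , y ⟩)
    no-cycle C C⊑ with two-positions C
    ... | i , j , i≢j = distinct C i j i≢j (trans (edge-is-y C C⊑ i) (sym (edge-is-y C C⊑ j)))

  digon : ∀ {u v g h} → u ≢ v → g ≢ h → Cycle
  digon {u} {v} {g} {h} u≢v g≢h = record
    { p        = 1
    ; 2≤m      = s≤s (s≤s z≤n)
    ; vs       = vertices
    ; gs       = gains
    ; vs-inj   = injective₂ vertices u≢v
    ; distinct = λ i j i≢j → i≢j ∘ injective₂ edges e₀≢e₁
    }
    where
    vertices = lookup (u ∷ v ∷ [])
    gains    = lookup (g ∷ h ⁻¹ ∷ [])
    edges : Fin 2 → Maybe El
    edges i = edgeOf (vertices i) (vertices (next i)) (gains i)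
    e₀≢e₁ : edgeOf u v g ≢ edgeOf v u (h ⁻¹)
    e₀≢e₁ eq = g≢h (edgeOf-injectiveʳ u≢v (trans eq (edgeOf-sym u v h)))

  digon-⊑ : ∀ {u v g h S} (u≢v : u ≢ v) (g≢h : g ≢ h) →
            edgeOf u v g ∈ₘ S → edgeOf u v h ∈ₘ S → digon u≢v g≢h ⊑ S
  digon-⊑ _ _ g∈S _ zero = g∈S
  digon-⊑ {u} {v} {h = h} {S} _ _ _ h∈S (suc zero) = subst (_∈ₘ S) (sym (edgeOf-sym u v h)) h∈S

  triangle : ∀ {u v w} → u ≢ v → v ≢ w → w ≢ u → (g₀ g₁ g₂ : Fin k) → Cycle
  triangle {u} {v} {w} u≢v v≢w w≢u g₀ g₁ g₂ = record
    { p        = 2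
    ; 2≤m      = s≤s (s≤s z≤n)
    ; vs       = vertices
    ; gs       = gains
    ; vs-inj   = injective₃ vertices u≢v (w≢u ∘ sym) v≢w
    ; distinct = λ i j i≢j → i≢j ∘ injective₃ edges e₀≢e₁ e₀≢e₂ e₁≢e₂
    }
    where
    vertices = lookup (u ∷ v ∷ w ∷ [])
    gains    = lookup (g₀ ∷ g₁ ∷ g₂ ∷ [])
    edges : Fin 3 → Maybe El
    edges i = edgeOf (vertices i) (vertices (next i)) (gains i)
    e₀≢e₁ : edgeOf u v g₀ ≢ edgeOf v w g₁
    e₀≢e₁ eq = [ u≢v , w≢u ∘ sym ]′ (edgeOf-endpoint u≢v eq)
    e₀≢e₂ : edgeOf u v g₀ ≢ edgeOf w u g₂
    e₀≢e₂ eq = [ v≢w , u≢v ∘ sym ]′ (edgeOf-endpoint (u≢v ∘ sym) (trans (edgeOf-sym u v g₀) eq))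
    e₁≢e₂ : edgeOf v w g₁ ≢ edgeOf w u g₂
    e₁≢e₂ eq = [ v≢w , u≢v ∘ sym ]′ (edgeOf-endpoint v≢w eq)

  triangle-balanced : ∀ {u v w} (u≢v : u ≢ v) (v≢w : v ≢ w) (w≢u : w ≢ u) {g₀ g₁ g₂} →
                      g₀ ∙ (g₁ ∙ g₂) ≡ ε → Balanced (triangle u≢v v≢w w≢u g₀ g₁ g₂)
  triangle-balanced _ _ _ {g₀} {g₁} {g₂} g₀g₁g₂≡ε =
    trans (cong (λ x → g₀ ∙ (g₁ ∙ x)) (identityʳ g₂)) g₀g₁g₂≡ε

  Full : Subset → Fin n → Fin n → Set
  Full F u v = ∀ g → edgeOf u v g ∈ₘ F

  Full-sym : ∀ F → Symmetric (Full F)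
  Full-sym F {u} {v} uv⊆F g = subst (_∈ₘ F) (edgeOf-sym v u g) (uv⊆F (g ⁻¹))

  parallel⇒∞∈flat : ∀ {F} u v {g h} → Flat F →
                      edgeOf u v g ∈ₘ F → edgeOf u v h ∈ₘ F → g ≢ h → ∞ ∈ₛ F
  parallel⇒∞∈flat u v {g} {h} flat g∈F h∈F g≢h with ∈ₘ⇒just g∈F | ∈ₘ⇒just h∈F
  ... | y , y-eq , y∈F | z , z-eq , z∈F =
    flat ∞ (inj₂ (⟨ y , z ⟩ , pair⊆ y∈F z∈F , yz-independent , dependent))
    where
    yz-independent = pair-independent (edgeOf≢∞ y-eq) (edgeOf≢∞ z-eq)
    dependent : ¬ Independent (insert ∞ ⟨ y , z ⟩)
    dependent (_ , ∞⇒no-cycle , _) =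
      ∞⇒no-cycle (insert-here ∞ ⟨ y , z ⟩) (digon (edgeOf-∈ₘ⇒≢ g∈F) g≢h)
        (digon-⊑ (edgeOf-∈ₘ⇒≢ g∈F) g≢h (≡just⇒∈ₘ y-eq (∈-insert-pairˡ ∞ y z))
                                       (≡just⇒∈ₘ z-eq (∈-insert-pairʳ ∞ y z)))

  ∞∈flat⇒Full : ∀ {F} u v {h} → Flat F → ∞ ∈ₛ F → edgeOf u v h ∈ₘ F → Full F u v
  ∞∈flat⇒Full u v {h} flat ∞∈F h∈F g with g ≟ h
  ... | yes refl = h∈F
  ... | no g≢h with ∈ₘ⇒just h∈F | edgeOf-just g (edgeOf-∈ₘ⇒≢ h∈F)
  ...   | z , z-eq , z∈F | x , x-eq =
    ≡just⇒∈ₘ x-eq (flat x (inj₂ (⟨ ∞ , z ⟩ , pair⊆ ∞∈F z∈F , ∞-pair-independent z , dependent)))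
    where
    dependent : ¬ Independent (insert x ⟨ ∞ , z ⟩)
    dependent (_ , ∞⇒no-cycle , _) =
      ∞⇒no-cycle (∈-insert-pairˡ x ∞ z) (digon (edgeOf-∈ₘ⇒≢ h∈F) g≢h)
        (digon-⊑ (edgeOf-∈ₘ⇒≢ h∈F) g≢h (≡just⇒∈ₘ x-eq (insert-here x _))
                                       (≡just⇒∈ₘ z-eq (∈-insert-pairʳ x ∞ z)))

  balanced-triangle-closed : ∀ {F} u v w g₀ g₁ g₂ → Flat F → w ≢ u → g₀ ∙ (g₁ ∙ g₂) ≡ ε →
                             edgeOf u v g₀ ∈ₘ F → edgeOf v w g₁ ∈ₘ F → edgeOf w u g₂ ∈ₘ F
  balanced-triangle-closed u v w g₀ g₁ g₂ flat w≢u g₀g₁g₂≡ε uv∈F vw∈F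
    with ∈ₘ⇒just uv∈F | ∈ₘ⇒just vw∈F | edgeOf-just g₂ w≢u
  ... | y , y-eq , y∈F | z , z-eq , z∈F | x , x-eq =
    ≡just⇒∈ₘ x-eq (flat x (inj₂ (⟨ y , z ⟩ , pair⊆ y∈F z∈F , yz-independent , dependent)))
    where
    yz-independent = pair-independent (edgeOf≢∞ y-eq) (edgeOf≢∞ z-eq)
    u≢v = edgeOf-∈ₘ⇒≢ uv∈F
    v≢w = edgeOf-∈ₘ⇒≢ vw∈F
    T = triangle u≢v v≢w w≢u g₀ g₁ g₂
    T⊑ : T ⊑ insert x ⟨ y , z ⟩
    T⊑ zero             = ≡just⇒∈ₘ y-eq (∈-insert-pairˡ x y z)
    T⊑ (suc zero)       = ≡just⇒∈ₘ z-eq (∈-insert-pairʳ x y z)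
    T⊑ (suc (suc zero)) = ≡just⇒∈ₘ x-eq (insert-here x _)
    dependent : ¬ Independent (insert x ⟨ y , z ⟩)
    dependent (no-balanced , _) = no-balanced T T⊑ (triangle-balanced u≢v v≢w w≢u g₀g₁g₂≡ε)

  Full-trans : ∀ {F} → Flat F → TransitiveOnDistinct (Full F)
  Full-trans {F} flat {u} {v} {w} _ _ u≢w uv⊆F vw⊆F g =
    subst (_∈ₘ F) (edgeOf-sym u w g)
      (balanced-triangle-closed u v w ε g (g ⁻¹) flat (u≢w ∘ sym) ε∙g∙g⁻¹≡ε (uv⊆F ε) (vw⊆F g))
    where
    ε∙g∙g⁻¹≡ε : ε ∙ (g ∙ (g ⁻¹)) ≡ ε
    ε∙g∙g⁻¹≡ε = trans (identityˡ _) (inverseʳ g)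

  cover-edgeOf : ∀ {F₁ F₂ u v} → (∀ e → e ∈ₛ F₁ ⊎ e ∈ₛ F₂) → u ≢ v →
                 ∀ g → edgeOf u v g ∈ₘ F₁ ⊎ edgeOf u v g ∈ₘ F₂
  cover-edgeOf cover u≢v g with edgeOf-just g u≢v
  ... | e , eq rewrite eq = cover e

  Full-everywhere⇒whole : ∀ {F} → ∞ ∈ₛ F → (∀ {u v} → u ≢ v → Full F u v) → ∀ e → e ∈ₛ F
  Full-everywhere⇒whole ∞∈F _    ∞                = ∞∈F
  Full-everywhere⇒whole {F} _ full (edge i j i<j g) =
    subst (_∈ₘ F) (edgeOf-< g i<j) (full (ends-distinct i<j) g)

  no-cover-with-∞ : ∀ {t} → t ≢ ε → ∀ {F₁ F₂} → ProperFlat F₁ → ProperFlat F₂ →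
                    (∀ e → e ∈ₛ F₁ ⊎ e ∈ₛ F₂) → ∞ ∈ₛ F₁ → ⊥
  no-cover-with-∞ _ (_ , ∞ , ∞∉F₁) _ _ ∞∈F₁ = ∞∉F₁ ∞∈F₁
  no-cover-with-∞ {t} t≢ε {F₁} {F₂} (flat₁ , edge a b a<b g , ab∉F₁) (flat₂ , x , x∉F₂) cover ∞∈F₁ =
    x∉F₂ (Full-everywhere⇒whole ∞∈F₂ Full₂ x)
    where
    a≢b = ends-distinct a<b

    ¬Full₁ : ¬ Full F₁ a b
    ¬Full₁ ab⊆F₁ = ab∉F₁ (subst (_∈ₘ F₁) (edgeOf-< g a<b) (ab⊆F₁ g))

    ab⊆F₂ : Full F₂ a b
    ab⊆F₂ h = [ ⊥-elim ∘ ¬Full₁ ∘ ∞∈flat⇒Full a b flat₁ ∞∈F₁ , id ]′ (cover-edgeOf cover a≢b h)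

    ∞∈F₂ : ∞ ∈ₛ F₂
    ∞∈F₂ = parallel⇒∞∈flat a b flat₂ (ab⊆F₂ t) (ab⊆F₂ ε) t≢ε

    Full₁⊎Full₂ : ∀ {u v} → u ≢ v → Full F₁ u v ⊎ Full F₂ u v
    Full₁⊎Full₂ {u} {v} u≢v =
      ⊎-map (∞∈flat⇒Full u v flat₁ ∞∈F₁) (∞∈flat⇒Full u v flat₂ ∞∈F₂) (cover-edgeOf cover u≢v ε)

    Full₂ : ∀ {u v} → u ≢ v → Full F₂ u v
    Full₂ = ¬R₁⇒R₂-total _≟_ Full₁⊎Full₂ (Full-sym F₁) (Full-sym F₂)
                         (Full-trans flat₁) (Full-trans flat₂) a≢b ¬Full₁

  round : ∀ {t} → t ≢ ε → Round
  round t≢ε (F₁ , F₂ , F₁-proper , F₂-proper , cover) with cover ∞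
  ... | inj₁ ∞∈F₁ = no-cover-with-∞ t≢ε F₁-proper F₂-proper cover ∞∈F₁
  ... | inj₂ ∞∈F₂ = no-cover-with-∞ t≢ε F₂-proper F₁-proper (swap ∘ cover) ∞∈F₂

proposition4p18 : (k : ℕ) (G : FinGroup k) → NonTrivial G → (n : ℕ) → LiftMatroid.Round G n
proposition4p18 k G (_ , t≢ε) n = round G n t≢ε
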